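{- Let $B$ be a bidirected graph, $x$ an edge-clean vertex of $B$, and $P$ a path in $B$ starting in $x$. Let $Q$ be a path in $B$ starting in $x$ that is edge-disjoint from $P$. Then $E(Q)\cap A(P,x)=\emptyset$.
   Context: A bidirected graph $B=(G,\sigma)$ consists of an undirected graph $G$ without loops (no two distinct edges have the same endvertices and the same signs at them) together with a signing $\sigma$ assigning to every pair $(u,e)$, $u$ an endvertex of edge $e$, a sign $\sigma(u,e)\in\{+,-\}$. An oriented edge is an edge with one endvertex chosen as startvertex and the other as endvertex; for a set $A$ of edges, $\overleftrightarrow{A}$ denotes the set of both orientations of all edges of $A$. A walk is a sequence $v_0\vec e_1v_1\dots\vec e_\ell v_\ell$ where $\vec e_j$ is the edge $e_j$ oriented from $v_{j-1}$ to $v_j$ and $\sigma(v_i,e_i)\neq\sigma(v_i,e_{i+1})$ for $1\le i\le\ell-1$; it is nontrivial if $\ell\ge1$. $E(W)$ is its set of edges $e_j$. A trail is a walk with distinct edges, a path a walk with distinct vertices. An $\vec e$--$x$ trail is a trail whose first oriented edge is $\vec e$ and whose last vertex is $x$; an $x$--$x$ trail is a nontrivial trail with first and last vertex $x$. A vertex $x$ is edge-clean if there is no nontrivial $x$--$x$ trail in $B$. For a path $P$ starting in $x$, a set $A\subseteq E(B)$ is $(P,x)$-admissible if for every $\vec e\in\overleftrightarrow{A}$ there is an $\vec e$--$x$ trail all of whose edges lie in $A\cup E(P)$. The appendage $A(P,x)$ is the union of all $(P,x)$-admissible sets. -}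

module Defs where

open import Level using (Level; _⊔_) renaming (suc to lsuc; zero to 0ℓ)
open import Data.Bool using (Bool; true; false; not)
open import Data.Product using (Σ; ∃; _×_; _,_; proj₁; proj₂)
open import Data.Sum using (_⊎_)
open import Data.Unit using (⊤)
open import Data.Empty using (⊥)
open import Data.List using (List; []; _∷_; map)
open import Data.List.Membership.Propositional using (_∈_)
open import Data.List.Relation.Unary.Unique.Propositional using (Unique)
open import Relation.Nullary using (¬_)
open import Relation.Binary.PropositionalEquality using (_≡_; _≢_)

data Sign : Set where
  plus minus : Sign

-- A bidirected graph: every edge e has two (distinct) endvertices
-- end e false, end e true, and a sign at each of them:
-- sign e b = σ(end e b, e).
record BidirectedGraph : Set₁ where
  field
    V        : Set
    E        : Set
    end      : E → Bool → V
    sign     : E → Bool → Sign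
    loopless : ∀ e → end e false ≢ end e true
    simple   : ∀ e e' → e ≢ e' →
      ¬ ((∀ b → end e b ≡ end e' b × sign e b ≡ sign e' b)
         ⊎ (∀ b → end e b ≡ end e' (not b) × sign e b ≡ sign e' (not b)))

module _ (B : BidirectedGraph) where
  open BidirectedGraph B

  OEdge : Set
  OEdge = E × Bool

  start : OEdge → V
  start (e , b) = end e b

  stop : OEdge → V
  stop (e , b) = end e (not b)

  startSign : OEdge → Sign
  startSign (e , b) = sign e b

  stopSign : OEdge → Sign
  stopSign (e , b) = sign e (not b)

  Compat : OEdge → List OEdge → Set
  Compat d []        = ⊤
  Compat d (d' ∷ _)  = stopSign d ≢ startSign d'

  IsWalk : V → List OEdge → V → Set
  IsWalk v []       w = v ≡ w
  IsWalk v (d ∷ ds) w = start d ≡ v × Compat d ds × IsWalk (stop d) ds w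

  edges : List OEdge → List E
  edges ds = map proj₁ ds

  EdgeOf : List OEdge → E → Set
  EdgeOf ds e = e ∈ edges ds

  vertices : V → List OEdge → List V
  vertices v ds = v ∷ map stop ds

  IsTrail : V → List OEdge → V → Set
  IsTrail v ds w = IsWalk v ds w × Unique (edges ds)

  IsPath : V → List OEdge → V → Set
  IsPath v ds w = IsWalk v ds w × Unique (vertices v ds)

  PathFrom : V → List OEdge → Set
  PathFrom x ds = Σ V λ w → IsPath x ds w

  EdgeClean : V → Set
  EdgeClean x = ¬ (Σ (List OEdge) λ ds → ds ≢ [] × IsTrail x ds x)

  TrailTo : OEdge → V → (E → Set) → Set
  TrailTo d x S = Σ (List OEdge) λ ds →
    IsTrail (start d) (d ∷ ds) x × (∀ f → EdgeOf (d ∷ ds) f → S f)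

  Admissible : List OEdge → V → (E → Set) → Set
  Admissible P x A = ∀ e → A e → ∀ b →
    TrailTo (e , b) x (λ f → A f ⊎ EdgeOf P f)

  Appendage : List OEdge → V → E → Set₁
  Appendage P x e = Σ (E → Set) λ A → Admissible P x A × A e

-- Suppose an edge of Q lay in an admissible set A, and let d be the first
-- edge of Q in A, so that Q = R d Q' with E(R) ∩ A = ∅. Admissibility yields
-- a d⃗--x trail T inside A ∪ E(P). Since R avoids A and, being part of Q,
-- also E(P), the walk R T is an x--x trail, contradicting edge-cleanness of x.
module Submission where

open import Defs
open import Data.Empty using (⊥)
open import Data.Bool using (false; true)
open import Data.List using (List; []; _∷_; _++_)
open import Data.List.Properties using (map-++; ++-conicalʳ)
open import Data.List.Membership.Propositional using (_∈_; lose)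
open import Data.List.Membership.Propositional.Properties using (∈-map⁺; ∈-map⁻; ∈-++⁺ˡ)
open import Data.List.Relation.Unary.Any using (Any; here; there)
open import Data.List.Relation.Unary.Any.Properties using (map⁻)
open import Data.List.Relation.Unary.All as All using (All; _∷_)
open import Data.List.Relation.Unary.All.Properties using (++⁻ˡ)
open import Data.List.Relation.Unary.AllPairs using ([]; _∷_)
open import Data.List.Relation.Unary.First as First using (First; FirstView)
open import Data.List.Relation.Unary.First.Properties using (toView)
open import Data.List.Relation.Unary.Unique.Propositional using (Unique)
open import Data.List.Relation.Unary.Unique.Propositional.Properties using (++⁺)
open import Data.List.Relation.Binary.Disjoint.Propositional using (Disjoint)
open import Data.Product using (_,_; proj₁; proj₂)
open import Data.Sum using (_⊎_; inj₁; inj₂)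
open import Function using (_∘_)
open import Relation.Nullary using (¬_; yes; no)
open import Relation.Nullary.Decidable using (¬¬-excluded-middle)
open import Relation.Unary using (Pred; ∁)
open import Relation.Binary.PropositionalEquality using (_≡_; refl; sym; subst)

module _ {a p} {X : Set a} {P : Pred X p} where

  -- Without decidability of P the first witness exists only up to double negation.
  Any⇒¬¬First : ∀ {xs} → Any P xs → ¬ ¬ First (∁ P) P xs
  Any⇒¬¬First (here px) ¬first = ¬first First.[ px ]
  Any⇒¬¬First (there pxs) ¬first = ¬¬-excluded-middle λ where
    (yes px) → ¬first First.[ px ]
    (no ¬px) → Any⇒¬¬First pxs (¬first ∘ (¬px First.∷_))

module _ {a} {X : Set a} where

  Unique-++⁻ˡ : ∀ xs {ys : List X} → Unique (xs ++ ys) → Unique xs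
  Unique-++⁻ˡ []       _        = []
  Unique-++⁻ˡ (x ∷ xs) (x∉ ∷ u) = ++⁻ˡ xs x∉ ∷ Unique-++⁻ˡ xs u

module _ (B : BidirectedGraph) where
  open BidirectedGraph B

  sameEdge⇒stop≡stop⊎stop≡start : ∀ {d d' : OEdge B} → proj₁ d ≡ proj₁ d' →
    stop B d' ≡ stop B d ⊎ stop B d' ≡ start B d
  sameEdge⇒stop≡stop⊎stop≡start {e , false} {.e , false} refl = inj₁ refl
  sameEdge⇒stop≡stop⊎stop≡start {e , false} {.e , true}  refl = inj₂ refl
  sameEdge⇒stop≡stop⊎stop≡start {e , true}  {.e , false} refl = inj₂ refl
  sameEdge⇒stop≡stop⊎stop≡start {e , true}  {.e , true}  refl = inj₁ refl

  path⇒unique-edges : ∀ {v} ds {w} → IsPath B v ds w → Unique (edges B ds)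
  path⇒unique-edges []       _ = []
  path⇒unique-edges (d ∷ ds) ((refl , _ , walk) , v∉ ∷ vs@(stop∉ ∷ _)) =
    All.tabulate fresh ∷ path⇒unique-edges ds (walk , vs)
    where
    fresh : ∀ {f} → f ∈ edges B ds → proj₁ d ≡ f → ⊥
    fresh f∈ refl with ∈-map⁻ proj₁ f∈
    ... | d' , d'∈ , e≡ with sameEdge⇒stop≡stop⊎stop≡start e≡
    ...   | inj₁ eq = All.lookup stop∉ (∈-map⁺ (stop B) d'∈) (sym eq)
    ...   | inj₂ eq = All.lookup v∉ (there (∈-map⁺ (stop B) d'∈)) (sym eq)

  path⇒trail : ∀ {v ds w} → IsPath B v ds w → IsTrail B v ds w
  path⇒trail {ds = ds} path = proj₁ path , path⇒unique-edges ds path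

  walk-reroute : ∀ {v} pre {d post w T y} → IsWalk B v (pre ++ d ∷ post) w →
    IsWalk B (start B d) (d ∷ T) y → IsWalk B v (pre ++ d ∷ T) y
  walk-reroute []                (start≡ , _)        (_ , walkT) = start≡ , walkT
  walk-reroute (_ ∷ [])          (start≡ , c , walk) walkT =
    start≡ , c , walk-reroute [] walk walkT
  walk-reroute (_ ∷ pre@(_ ∷ _)) (start≡ , c , walk) walkT =
    start≡ , c , walk-reroute pre walk walkT

  trail-reroute : ∀ {v} pre {d post w T y} → IsTrail B v (pre ++ d ∷ post) w →
    IsTrail B (start B d) (d ∷ T) y → Disjoint (edges B pre) (edges B (d ∷ T)) →
    IsTrail B v (pre ++ d ∷ T) y
  trail-reroute pre {d} {post} {T = T} (walk , unique) (walkT , uniqueT) disjoint =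
    walk-reroute pre walk walkT ,
    subst Unique (sym (map-++ proj₁ pre (d ∷ T)))
      (++⁺ (Unique-++⁻ˡ (edges B pre) (subst Unique (map-++ proj₁ pre (d ∷ post)) unique))
           uniqueT disjoint)

  module _ {x P A} (clean : EdgeClean B x) (admissible : Admissible B P x A) where

    ¬firstAppendageEdge : ∀ {Q w} → IsPath B x Q w →
      (∀ e → EdgeOf B P e → EdgeOf B Q e → ⊥) →
      ¬ FirstView (∁ (A ∘ proj₁)) (A ∘ proj₁) Q
    ¬firstAppendageEdge path disjointPQ (First._++_∷_ {pre} {d} ∉A Ad _)
      with admissible (proj₁ d) Ad (proj₂ d)
    ... | T , trailT , T⊆A∪P =
      clean (pre ++ d ∷ T , (λ ()) ∘ ++-conicalʳ pre (d ∷ T) ,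
             trail-reroute pre (path⇒trail path) trailT disjoint)
      where
      disjoint : Disjoint (edges B pre) (edges B (d ∷ T))
      disjoint (f∈pre , f∈dT) with ∈-map⁻ proj₁ f∈pre
      ... | d' , d'∈pre , refl with T⊆A∪P _ f∈dT
      ...   | inj₁ Af = All.lookup ∉A d'∈pre Af
      ...   | inj₂ f∈P = disjointPQ _ f∈P (∈-map⁺ proj₁ (∈-++⁺ˡ d'∈pre))

lemma4p4 : (B : BidirectedGraph) (x : BidirectedGraph.V B)
    (P Q : List (OEdge B)) →
    EdgeClean B x → PathFrom B x P → PathFrom B x Q →
    (∀ e → EdgeOf B P e → EdgeOf B Q e → ⊥) →
    ∀ e → EdgeOf B Q e → Appendage B P x e → ⊥
lemma4p4 B x P Q clean _ (_ , pathQ) disjointPQ e e∈Q (A , admissible , Ae) =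
  Any⇒¬¬First (map⁻ (lose {P = A} e∈Q Ae))
    (¬firstAppendageEdge B clean admissible pathQ disjointPQ ∘ toView)
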